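{- Let $b \geq 2$ and $m \geq 1$ be integers and let $\mathbf t_{b,m}$ be the generalized Thue-Morse word over $\mathbb Z_m$. Then the language $\mathcal L(\mathbf t_{b,m})$ is closed under every element of $D_m$, i.e., for every $\nu \in D_m$ and every $w \in \mathcal L(\mathbf t_{b,m})$ we have $\nu(w) \in \mathcal L(\mathbf t_{b,m})$.
   Context: For an integer $n \geq 0$, $s_b(n)$ denotes the sum of digits of the base-$b$ representation of $n$. The generalized Thue-Morse word is the infinite word $\mathbf t_{b,m} = (s_b(n) \bmod m)_{n=0}^{+\infty}$ over the alphabet $\mathbb Z_m=\{0,1,\dots,m-1\}$. The language $\mathcal L(\mathbf u)$ of an infinite word $\mathbf u$ is the set of all its finite factors. A morphism $\varphi$ of $\mathbb Z_m^*$ satisfies $\varphi(vw)=\varphi(v)\varphi(w)$; an antimorphism satisfies $\varphi(vw)=\varphi(w)\varphi(v)$. For $x \in \mathbb Z_m$, $\Psi_x$ is the antimorphism with $\Psi_x(k) = x-k$ for letters $k\in\mathbb Z_m$, and $\Pi_x$ is the morphism with $\Pi_x(k)=x+k$ (arithmetic modulo $m$). $D_m = \{\Psi_x : x \in \mathbb Z_m\} \cup \{\Pi_x : x\in \mathbb Z_m\}$ (a group under composition isomorphic to the dihedral group of order $2m$). -}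

module Defs where

open import Data.Nat using (ℕ; zero; suc; _+_; _∸_; NonZero)
open import Data.Nat.DivMod using (_/_; _%_; m%n<n)
open import Data.Fin using (Fin)
import Data.Fin as F
open import Data.List using (List; []; _∷_; length; map; reverse; lookup)
open import Data.Product using (∃; _×_)
open import Relation.Binary.PropositionalEquality using (_≡_)

-- Sum of base-b digits of n, computed with a fuel argument.
-- digitSumFuel f b n is correct whenever f ≥ n (since n / b < n for n ≥ 1, b ≥ 2);
-- digitSum uses fuel n.
digitSumFuel : ℕ → (b : ℕ) → .{{NonZero b}} → ℕ → ℕ
digitSumFuel zero    b n = 0
digitSumFuel (suc f) b zero = 0
digitSumFuel (suc f) b n@(suc _) = n % b + digitSumFuel f b (n / b)

digitSum : (b : ℕ) → .{{NonZero b}} → ℕ → ℕ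
digitSum b n = digitSumFuel n b n

modFin : (m : ℕ) → .{{NonZero m}} → ℕ → Fin m
modFin m k = F.fromℕ< (m%n<n k m)

thueMorse : (b m : ℕ) → .{{NonZero b}} → .{{NonZero m}} → ℕ → Fin m
thueMorse b m n = modFin m (digitSum b n)

InLanguage : {A : Set} → (ℕ → A) → List A → Set
InLanguage u w = ∃ λ i → (j : Fin (length w)) → u (i + F.toℕ j) ≡ lookup w j

data Dihedral (m : ℕ) : Set where
  Ψ : Fin m → Dihedral m
  Π : Fin m → Dihedral m

addMod : {m : ℕ} → Fin m → Fin m → Fin m
addMod {suc m} x k = F.fromℕ< (m%n<n (F.toℕ x + F.toℕ k) (suc m))

negMod : {m : ℕ} → Fin m → Fin m
negMod {suc m} k = F.fromℕ< (m%n<n (suc m ∸ F.toℕ k) (suc m))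

apply : {m : ℕ} → Dihedral m → List (Fin m) → List (Fin m)
apply (Ψ x) w = reverse (map (λ k → addMod x (negMod k)) w)
apply (Π x) w = map (addMod x) w

-- For Π_x: adding a power
-- of b exceeding n raises s_b(n) by exactly one, so adding x such powers gives an N with
-- s_b(N + n) = x + s_b(n) on a whole window of n, which carries a factor to its image.
-- For Ψ_0: n ↦ b^k - 1 - n complements every base-b digit, so s_b(n) + s_b(b^k - 1 - n)
-- = k(b - 1), which vanishes modulo m once m ∣ k; this carries a factor to its reversed
-- negation.  Finally Ψ_x = Π_x ∘ Ψ_0.
module Submission where

open import Defs
open import Data.Nat using (ℕ; _≥_; NonZero)
open import Data.List using (List)
open import Data.Fin using (Fin)

open import Data.Nat using (zero; suc; _+_; _*_; _∸_; _^_; _≤_; _<_; s≤s; s≤s⁻¹; z<s; s<s; pred; ≢-nonZero⁻¹)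
open import Data.Nat.Properties
open import Data.Nat.DivMod
open import Data.Nat.Divisibility using (n∣m*n)
open import Data.Nat.Tactic.RingSolver using (solve-∀)
open import Data.Fin using (toℕ)
open import Data.Fin.Properties using (toℕ-fromℕ<; toℕ-injective)
open import Data.List using ([]; _∷_; length; map; reverse; lookup; applyUpTo; applyDownFrom)
open import Data.List.Properties using (lookup-applyUpTo; map-applyUpTo; reverse-applyUpTo; reverse-map; map-∘)
open import Data.Product using (∃; _×_; _,_)
open import Data.Empty using (⊥-elim)
open import Function using (_∘_)
open import Relation.Binary.PropositionalEquality

module _ {A : Set} where

  factor : (ℕ → A) → ℕ → ℕ → List A
  factor u i L = applyUpTo (λ j → u (i + j)) L

  applyUpTo-cong-< : {f g : ℕ → A} (n : ℕ) → (∀ j → j < n → f j ≡ g j) →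
                     applyUpTo f n ≡ applyUpTo g n
  applyUpTo-cong-< zero    f≡g = refl
  applyUpTo-cong-< (suc n) f≡g =
    cong₂ _∷_ (f≡g 0 z<s) (applyUpTo-cong-< n (λ j j<n → f≡g (suc j) (s<s j<n)))

  applyDownFrom≡applyUpTo : (f : ℕ → A) (n : ℕ) →
                            applyDownFrom f n ≡ applyUpTo (λ j → f (n ∸ suc j)) n
  applyDownFrom≡applyUpTo f zero    = refl
  applyDownFrom≡applyUpTo f (suc n) = cong (f n ∷_) (applyDownFrom≡applyUpTo f n)

  lookup⇒applyUpTo : (g : ℕ → A) (w : List A) → (∀ j → g (toℕ j) ≡ lookup w j) →
                     w ≡ applyUpTo g (length w)
  lookup⇒applyUpTo g []      eq = refl
  lookup⇒applyUpTo g (a ∷ w) eq =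
    cong₂ _∷_ (sym (eq Data.Fin.zero)) (lookup⇒applyUpTo (g ∘ suc) w (eq ∘ Data.Fin.suc))

  factor-∈ : (u : ℕ → A) (i L : ℕ) → InLanguage u (factor u i L)
  factor-∈ u i L = i , λ j → sym (lookup-applyUpTo (λ j → u (i + j)) L j)

  InLanguage-closed : (u : ℕ → A) (F : List A → List A) →
                      (∀ i L → ∃ λ i' → F (factor u i L) ≡ factor u i' L) →
                      ∀ w → InLanguage u w → InLanguage u (F w)
  InLanguage-closed u F F-factor w (i , occ) =
    let (i' , F[factor]≡factor) = F-factor i (length w) in
    subst (InLanguage u)
          (sym (trans (cong F (lookup⇒applyUpTo _ w occ)) F[factor]≡factor))
          (factor-∈ u i' (length w))

module DigitSum (b : ℕ) .{{_ : NonZero b}} (1<b : 1 < b) where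

  s : ℕ → ℕ
  s = digitSum b

  suc-n/b≤n : ∀ n → suc n / b ≤ n
  suc-n/b≤n n = s≤s⁻¹ (m/n<m (suc n) b 1<b)

  n/b<b^k : ∀ k n → n < b ^ suc k → n / b < b ^ k
  n/b<b^k k n n<b^k+1 = m<n*o⇒m/o<n (subst (n <_) (*-comm b (b ^ k)) n<b^k+1)

  digitSumFuel-enough : ∀ f g n → n ≤ f → n ≤ g → digitSumFuel f b n ≡ digitSumFuel g b n
  digitSumFuel-enough zero    zero    zero    _ _ = refl
  digitSumFuel-enough zero    (suc g) zero    _ _ = refl
  digitSumFuel-enough (suc f) zero    zero    _ _ = refl
  digitSumFuel-enough (suc f) (suc g) zero    _ _ = refl
  digitSumFuel-enough (suc f) (suc g) (suc n) (s≤s n≤f) (s≤s n≤g) =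
    cong (suc n % b +_) (digitSumFuel-enough f g (suc n / b) (≤-trans (suc-n/b≤n n) n≤f) (≤-trans (suc-n/b≤n n) n≤g))

  digitSum-step : ∀ n → s n ≡ n % b + s (n / b)
  digitSum-step zero    = sym (cong₂ (λ d q → d + s q) (m<n⇒m%n≡m (<-trans z<s 1<b)) (0/n≡0 b))
  digitSum-step (suc n) =
    cong (suc n % b +_) (digitSumFuel-enough n (suc n / b) (suc n / b) (suc-n/b≤n n) ≤-refl)

  digitSum-digit : ∀ r q → r < b → s (r + q * b) ≡ r + s q
  digitSum-digit r q r<b = begin
    s (r + q * b)                          ≡⟨ digitSum-step (r + q * b) ⟩
    (r + q * b) % b + s ((r + q * b) / b)  ≡⟨ cong₂ (λ d q′ → d + s q′) last-digit quotient ⟩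
    r + s q                                ∎
    where
    open ≡-Reasoning
    last-digit : (r + q * b) % b ≡ r
    last-digit = trans ([m+kn]%n≡m%n r q b) (m<n⇒m%n≡m r<b)
    quotient : (r + q * b) / b ≡ q
    quotient = trans (+-distrib-/-∣ʳ r (n∣m*n q)) (cong₂ _+_ (m<n⇒m/n≡0 r<b) (m*n/n≡m q b))

  n<b^n : ∀ n → n < b ^ n
  n<b^n zero    = z<s
  n<b^n (suc n) = ≤-<-trans (n<b^n n) (subst (b ^ n <_) (*-comm (b ^ n) b) (m<m*n (b ^ n) b {{m^n≢0 b n}} 1<b))

  digitSum-leading : ∀ k n → n < b ^ k → s (b ^ k + n) ≡ suc (s n)
  digitSum-leading zero    zero    _         = digitSum-digit 1 0 1<b
  digitSum-leading zero    (suc n) (s≤s ())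
  digitSum-leading (suc k) n n<b^k+1 = begin
    s (b * b ^ k + n)                    ≡⟨ cong s (cong₂ _+_ (*-comm b (b ^ k)) (m≡m%n+[m/n]*n n b)) ⟩
    s (b ^ k * b + (n % b + n / b * b))  ≡⟨ cong s (carry (b ^ k) (n % b) (n / b) b) ⟩
    s (n % b + (b ^ k + n / b) * b)      ≡⟨ digitSum-digit (n % b) (b ^ k + n / b) (m%n<n n b) ⟩
    n % b + s (b ^ k + n / b)            ≡⟨ cong (n % b +_) (digitSum-leading k (n / b) (n/b<b^k k n n<b^k+1)) ⟩
    n % b + suc (s (n / b))              ≡⟨ +-suc (n % b) (s (n / b)) ⟩
    suc (n % b + s (n / b))              ≡⟨ cong suc (digitSum-step n) ⟨
    suc (s n)                            ∎
    where
    open ≡-Reasoning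
    carry : ∀ p r q b → p * b + (r + q * b) ≡ r + (p + q) * b
    carry = solve-∀

  digitSum-shift : ∀ t B → ∃ λ N → ∀ n → n < B → s (N + n) ≡ t + s n
  digitSum-shift zero    B = 0 , λ n _ → refl
  digitSum-shift (suc t) B =
    let (N , shifted) = digitSum-shift t B in
    b ^ (N + B) + N , λ n n<B → begin
      s (b ^ (N + B) + N + n)    ≡⟨ cong s (+-assoc (b ^ (N + B)) N n) ⟩
      s (b ^ (N + B) + (N + n))  ≡⟨ digitSum-leading (N + B) (N + n) (<-trans (+-monoʳ-< N n<B) (n<b^n (N + B))) ⟩
      suc (s (N + n))            ≡⟨ cong suc (shifted n n<B) ⟩
      suc t + s n                ∎
    where open ≡-Reasoning

  digitSum-complement : ∀ k n → n < b ^ k →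
                        ∃ λ n' → n + n' + 1 ≡ b ^ k × s n + s n' ≡ k * pred b
  digitSum-complement zero    zero    _         = 0 , refl , refl
  digitSum-complement zero    (suc n) (s≤s ())
  digitSum-complement (suc k) n n<b^k+1 =
    let (q' , q+q'+1≡b^k , sq+sq'≡) = digitSum-complement k q (n/b<b^k k n n<b^k+1) in
    r' + q' * b , sum-complement q' q+q'+1≡b^k , digitSum-complement-step q' sq+sq'≡
    where
    open ≡-Reasoning
    q = n / b
    r = n % b
    r' = pred b ∸ r
    r+r'≡pred-b : r + r' ≡ pred b
    r+r'≡pred-b = m+[n∸m]≡n (<⇒≤pred (m%n<n n b))
    r'<b : r' < b
    r'<b = subst (r' <_) (suc-pred b) (s≤s (m∸n≤m (pred b) r))
    sum-complement : ∀ q' → q + q' + 1 ≡ b ^ k → n + (r' + q' * b) + 1 ≡ b * b ^ k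
    sum-complement q' q+q'+1≡b^k = begin
      n + (r' + q' * b) + 1              ≡⟨ cong (λ n → n + (r' + q' * b) + 1) (m≡m%n+[m/n]*n n b) ⟩
      r + q * b + (r' + q' * b) + 1      ≡⟨ regroup r q r' q' b ⟩
      suc (r + r') + (q + q') * b        ≡⟨ cong (λ d → suc d + (q + q') * b) r+r'≡pred-b ⟩
      suc (pred b) + (q + q') * b        ≡⟨ cong (_+ (q + q') * b) (suc-pred b) ⟩
      b + (q + q') * b                   ≡⟨ collect q q' b ⟩
      (q + q' + 1) * b                   ≡⟨ cong (_* b) q+q'+1≡b^k ⟩
      b ^ k * b                          ≡⟨ *-comm (b ^ k) b ⟩
      b * b ^ k                          ∎
      where
      regroup : ∀ r q r' q' b → r + q * b + (r' + q' * b) + 1 ≡ suc (r + r') + (q + q') * b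
      regroup = solve-∀
      collect : ∀ q q' b → b + (q + q') * b ≡ (q + q' + 1) * b
      collect = solve-∀
    digitSum-complement-step : ∀ q' → s q + s q' ≡ k * pred b → s n + s (r' + q' * b) ≡ suc k * pred b
    digitSum-complement-step q' sq+sq'≡ = begin
      s n + s (r' + q' * b)        ≡⟨ cong₂ _+_ (digitSum-step n) (digitSum-digit r' q' r'<b) ⟩
      r + s q + (r' + s q')        ≡⟨ regroup r (s q) r' (s q') ⟩
      (r + r') + (s q + s q')      ≡⟨ cong₂ _+_ r+r'≡pred-b sq+sq'≡ ⟩
      pred b + k * pred b          ∎
      where
      regroup : ∀ a b c d → a + b + (c + d) ≡ (a + c) + (b + d)
      regroup = solve-∀

module _ {m : ℕ} where

  private
    M : ℕ
    M = suc m

  addMod-modFin : ∀ (x : Fin M) a → addMod x (modFin M a) ≡ modFin M (toℕ x + a)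
  addMod-modFin x a = toℕ-injective (begin
    toℕ (addMod x (modFin M a))     ≡⟨ toℕ-fromℕ< _ ⟩
    (toℕ x + toℕ (modFin M a)) % M  ≡⟨ cong (λ r → (toℕ x + r) % M) (toℕ-fromℕ< _) ⟩
    (toℕ x + a % M) % M             ≡⟨ %-distribˡ-+ (toℕ x) (a % M) M ⟩
    (toℕ x % M + a % M % M) % M     ≡⟨ cong (λ r → (toℕ x % M + r) % M) (m%n%n≡m%n a M) ⟩
    (toℕ x % M + a % M) % M         ≡⟨ %-distribˡ-+ (toℕ x) a M ⟨
    (toℕ x + a) % M                 ≡⟨ toℕ-fromℕ< _ ⟨
    toℕ (modFin M (toℕ x + a))      ∎)
    where open ≡-Reasoning

  negMod-modFin : ∀ a a' q → a + a' ≡ q * M → negMod (modFin M a) ≡ modFin M a'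
  negMod-modFin a a' q a+a'≡qM = toℕ-injective (begin
    toℕ (negMod (modFin M a))       ≡⟨ toℕ-fromℕ< _ ⟩
    (M ∸ toℕ (modFin M a)) % M      ≡⟨ cong (λ r → (M ∸ r) % M) (toℕ-fromℕ< (m%n<n a M)) ⟩
    (M ∸ a % M) % M                 ≡⟨ [m+kn]%n≡m%n (M ∸ a % M) q M ⟨
    (M ∸ a % M + q * M) % M         ≡⟨ cong (_% M) inverse ⟩
    (a' + suc (a / M) * M) % M      ≡⟨ [m+kn]%n≡m%n a' (suc (a / M)) M ⟩
    a' % M                          ≡⟨ toℕ-fromℕ< _ ⟨
    toℕ (modFin M a')               ∎)
    where
    open ≡-Reasoning
    inverse : M ∸ a % M + q * M ≡ a' + suc (a / M) * M
    inverse = begin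
      M ∸ a % M + q * M                      ≡⟨ cong (M ∸ a % M +_) a+a'≡qM ⟨
      M ∸ a % M + (a + a')                   ≡⟨ cong (λ n → M ∸ a % M + (n + a')) (m≡m%n+[m/n]*n a M) ⟩
      M ∸ a % M + (a % M + a / M * M + a')   ≡⟨ regroup (M ∸ a % M) (a % M) (a / M * M) a' ⟩
      (M ∸ a % M + a % M) + a / M * M + a'   ≡⟨ cong (λ d → d + a / M * M + a') (m∸n+n≡m (m%n≤n a M)) ⟩
      M + a / M * M + a'                     ≡⟨ +-comm (M + a / M * M) a' ⟩
      a' + suc (a / M) * M                   ∎
      where
      regroup : ∀ d r k a' → d + (r + k + a') ≡ d + r + k + a'
      regroup = solve-∀

  Ψ≡Π∘Ψ₀ : ∀ (x : Fin M) w → apply (Ψ x) w ≡ map (addMod x) (reverse (map negMod w))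
  Ψ≡Π∘Ψ₀ x w = begin
    reverse (map (addMod x ∘ negMod) w)           ≡⟨ cong reverse (map-∘ w) ⟩
    reverse (map (addMod x) (map negMod w))       ≡⟨ reverse-map (addMod x) (map negMod w) ⟨
    map (addMod x) (reverse (map negMod w))       ∎
    where open ≡-Reasoning

module ThueMorseWord (b : ℕ) .{{_ : NonZero b}} (1<b : 1 < b) (m : ℕ) where

  open DigitSum b 1<b

  private
    M : ℕ
    M = suc m

  tm : ℕ → Fin M
  tm = thueMorse b M

  tm-shift : ∀ (x : Fin M) B → ∃ λ N → ∀ n → n < B → addMod x (tm n) ≡ tm (N + n)
  tm-shift x B =
    let (N , shifted) = digitSum-shift (toℕ x) B in
    N , λ n n<B → trans (addMod-modFin x (s n)) (cong (modFin M) (sym (shifted n n<B)))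

  tm-mirror : ∀ B → ∃ λ Q → B ≤ Q × (∀ n n' → n + n' + 1 ≡ Q → negMod (tm n) ≡ tm n')
  tm-mirror B = b ^ k , <⇒≤ (≤-<-trans (m≤m*n B M) (n<b^n k)) , mirror
    where
    k = B * M
    right-comm : ∀ x y z → x * y * z ≡ x * z * y
    right-comm = solve-∀
    mirror : ∀ n n' → n + n' + 1 ≡ b ^ k → negMod (tm n) ≡ tm n'
    mirror n n' n+n'+1≡b^k =
      let n<b^k = subst (n <_) n+n'+1≡b^k (≤-<-trans (m≤m+n n n') (m<m+n (n + n') z<s))
          (n'' , n+n''+1≡b^k , sn+sn''≡) = digitSum-complement k n n<b^k
          n''≡n' = +-cancelˡ-≡ n n'' n' (+-cancelʳ-≡ 1 (n + n'') (n + n') (trans n+n''+1≡b^k (sym n+n'+1≡b^k)))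
      in negMod-modFin (s n) (s n') (B * pred b)
           (trans (subst (λ n'' → s n + s n'' ≡ k * pred b) n''≡n' sn+sn''≡) (right-comm B M (pred b)))

  Π-factor : ∀ (x : Fin M) i L → ∃ λ i' → map (addMod x) (factor tm i L) ≡ factor tm i' L
  Π-factor x i L =
    let (N , shifted) = tm-shift x (i + L) in
    N + i , (begin
      map (addMod x) (factor tm i L)                ≡⟨ map-applyUpTo (λ j → tm (i + j)) (addMod x) L ⟩
      applyUpTo (λ j → addMod x (tm (i + j))) L     ≡⟨ applyUpTo-cong-< L (λ j j<L →
                                                         trans (shifted (i + j) (+-monoʳ-< i j<L)) (cong tm (sym (+-assoc N i j)))) ⟩
      factor tm (N + i) L                           ∎)
    where open ≡-Reasoning

  Ψ₀-factor : ∀ i L → ∃ λ i' → reverse (map negMod (factor tm i L)) ≡ factor tm i' L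
  Ψ₀-factor i L =
    let (Q , i+L≤Q , mirror) = tm-mirror (i + L)
        i' = Q ∸ (i + L)
        mirrored : ∀ j → j < L → i + (L ∸ suc j) + (i' + j) + 1 ≡ Q
        mirrored j j<L = begin
          i + (L ∸ suc j) + (i' + j) + 1      ≡⟨ regroup i (L ∸ suc j) i' j ⟩
          i' + (i + (L ∸ suc j + suc j))      ≡⟨ cong (λ l → i' + (i + l)) (m∸n+n≡m j<L) ⟩
          i' + (i + L)                        ≡⟨ m∸n+n≡m i+L≤Q ⟩
          Q                                   ∎
    in i' , (begin
      reverse (map negMod (factor tm i L))                 ≡⟨ cong reverse (map-applyUpTo (λ j → tm (i + j)) negMod L) ⟩
      reverse (applyUpTo (λ j → negMod (tm (i + j))) L)    ≡⟨ reverse-applyUpTo (λ j → negMod (tm (i + j))) L ⟩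
      applyDownFrom (λ j → negMod (tm (i + j))) L          ≡⟨ applyDownFrom≡applyUpTo (λ j → negMod (tm (i + j))) L ⟩
      applyUpTo (λ j → negMod (tm (i + (L ∸ suc j)))) L    ≡⟨ applyUpTo-cong-< L (λ j j<L → mirror (i + (L ∸ suc j)) (i' + j) (mirrored j j<L)) ⟩
      factor tm i' L                                       ∎)
    where
    open ≡-Reasoning
    regroup : ∀ i l i' j → i + l + (i' + j) + 1 ≡ i' + (i + (l + suc j))
    regroup = solve-∀

  Π-closed : ∀ x v → InLanguage tm v → InLanguage tm (map (addMod x) v)
  Π-closed x = InLanguage-closed tm (map (addMod x)) (Π-factor x)

  Ψ₀-closed : ∀ v → InLanguage tm v → InLanguage tm (reverse (map negMod v))
  Ψ₀-closed = InLanguage-closed tm (reverse ∘ map negMod) Ψ₀-factor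

proposition2 : (b m : ℕ) → .{{_ : NonZero b}} → .{{_ : NonZero m}} → b ≥ 2 →
               (ν : Dihedral m) (w : List (Fin m)) →
               InLanguage (thueMorse b m) w → InLanguage (thueMorse b m) (apply ν w)
proposition2 b zero    {{_}} {{m≢0}} _ _ _ _ = ⊥-elim (≢-nonZero⁻¹ 0 {{m≢0}} refl)
proposition2 b (suc m) 1<b ν w = closed ν
  where
  open ThueMorseWord b 1<b m

  closed : ∀ ν → InLanguage tm w → InLanguage tm (apply ν w)
  closed (Π x)     = Π-closed x w
  closed (Ψ x) occ =
    subst (InLanguage tm) (sym (Ψ≡Π∘Ψ₀ x w)) (Π-closed x (reverse (map negMod w)) (Ψ₀-closed w occ))
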